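{- In the level-$i$ priority queue $pQ_i$ described in the context, the operational cost $T_{tunnel,i}$ of tunnel() on level $i$ is $O(T_{insert,i-1})$, where $T_{insert,i-1}$ is the cost of insert() on level $i-1$.
   Context: The priority queue is built in levels. The level-1 queue $pQ_1$ consists of common-heaps (binary max-heaps stored in arrays), a meta-heap (a binary max-heap of pointers to the common-heaps, ordered by their local max keys) and a hash table mapping item IDs to common-heap IDs. For $i\ge 2$, the level-$i$ queue $pQ_i$ consists of $k_i$ common-heaps, each of which is itself a level-$(i-1)$ priority queue (of expected size $n_{i-1}$), a level-$i$ meta-heap of pointers to these common-heaps ordered by their local max keys, and a level-$i$ hash table mapping item IDs to common-heap IDs. Fix a constant $c$ and $t_B=2^c$; meta-heap updates for common-heaps at meta-heap indices in $[0,t_B)$ cost $O(1)$. Level-$i$ tunnel() inserts an item $x$ as follows: a common-heap $A$ is selected uniformly (cyclically) from the level-$i$ meta-heap index interval $[0,t_B)$; the location of $x$ is recorded in the level-$i$ hash table; the level-$(i-1)$ insert() is invoked on $A$ with $x$; if $x$ is now the local max item of $A$, the level-$i$ meta-heap is updated. -}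

module Defs where

open import Data.Nat using (ℕ; zero; suc; _+_; _*_; _^_; _≤_; _<ᵇ_; _≡ᵇ_)
open import Data.Nat.DivMod using (_/_; _%_)
open import Data.Nat.Properties using (m^n≢0)
open import Data.Bool using (Bool; true; false; if_then_else_)
open import Data.Maybe using (Maybe; just; nothing)
open import Data.Product using (_×_; _,_; proj₁; proj₂)
open import Data.List using (List; _∷_)

record Item : Set where
  constructor item
  field
    iid : ℕ
    key : ℕ
open Item public

-- Abstract level-(i-1) priority queue (a common-heap of level i).
-- Only the operations tunnel() uses are exposed: insert() with its
-- operational cost T_insert,i-1 (which may depend on the queue and item),
-- and the local max item.

record LowerPQ : Set₁ where
  field
    Carrier     : Set
    insert      : Carrier → Item → Carrier
    insertCost  : Carrier → Item → ℕ
    insertCost≥1 : ∀ q x → 1 ≤ insertCost q x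
    localMax    : Carrier → Maybe Item

-- Level-i queue state.
--   heaps   : common-heap ID ↦ common-heap (a level-(i-1) queue), IDs 0..k-1
--   meta    : level-i meta-heap stored as an array: index ↦ common-heap ID
--   hash    : level-i hash table, list of (item ID , common-heap ID)
--   counter : cyclic counter used to select an index in [0 , t_B)

record State (L : LowerPQ) : Set where
  field
    heaps   : ℕ → LowerPQ.Carrier L
    meta    : ℕ → ℕ
    hash    : List (ℕ × ℕ)
    counter : ℕ
open State public

tB : ℕ → ℕ
tB c = 2 ^ c

maxKey : (L : LowerPQ) → LowerPQ.Carrier L → ℕ
maxKey L q with LowerPQ.localMax L q
... | just y  = key y
... | nothing = 0

update : {A : Set} → (ℕ → A) → ℕ → A → ℕ → A
update f i a j = if j ≡ᵇ i then a else f j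

swap : (ℕ → ℕ) → ℕ → ℕ → ℕ → ℕ
swap f i j n = if n ≡ᵇ i then f j else (if n ≡ᵇ j then f i else f n)

-- Sift-up in an array-stored binary max-heap (parent of p+1 is p/2).
-- keyOf gives the key of an entry; the fuel argument only ensures
-- termination (initialised to the start index, which suffices).
siftUp : (ℕ → ℕ) → (ℕ → ℕ) → ℕ → ℕ → (ℕ → ℕ) × ℕ
siftUp keyOf arr zero    p       = arr , 0
siftUp keyOf arr (suc f) zero    = arr , 0
siftUp keyOf arr (suc f) (suc q) =
  if keyOf (arr (q / 2)) <ᵇ keyOf (arr (suc q))
  then (let r = siftUp keyOf (swap arr (q / 2) (suc q)) f (q / 2)
        in proj₁ r , suc (proj₂ r))
  else (arr , 0)

metaUpdate : (L : LowerPQ) → (ℕ → LowerPQ.Carrier L) → (ℕ → ℕ) → ℕ → (ℕ → ℕ) × ℕ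
metaUpdate L hs arr j =
  let r = siftUp (λ h → maxKey L (hs h)) arr j j in proj₁ r , suc (proj₂ r)

-- Level-i tunnel(x): returns the new state and its operational cost.
--   1 unit : cyclic selection of a meta-heap index j ∈ [0 , t_B), A = meta j
--   1 unit : recording (iid x , A) in the level-i hash table (O(1) hashing)
--   T_insert,i-1 : level-(i-1) insert of x into A
--   meta-heap update cost, only if x is now the local max item of A.

isLocalMax : (L : LowerPQ) → LowerPQ.Carrier L → Item → Bool
isLocalMax L q x with LowerPQ.localMax L q
... | just y  = iid y ≡ᵇ iid x
... | nothing = false

tunnel : (c : ℕ) (L : LowerPQ) → State L → Item → State L × ℕ
tunnel c L s x =
  let j      = _%_ (counter s) (tB c) {{m^n≢0 2 c}}
      A      = meta s j
      hash'  = (iid x , A) ∷ hash s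
      qA'    = LowerPQ.insert L (heaps s A) x
      heaps' = update (heaps s) A qA'
      tIns   = LowerPQ.insertCost L (heaps s A) x
  in if isLocalMax L qA' x
     then (let r = metaUpdate L heaps' (meta s) j
           in record { heaps = heaps' ; meta = proj₁ r ; hash = hash'
                     ; counter = suc (counter s) }
              , 1 + 1 + tIns + proj₂ r)
     else (record { heaps = heaps' ; meta = meta s ; hash = hash'
                  ; counter = suc (counter s) }
           , 1 + 1 + tIns)

tunnelCost : (c : ℕ) (L : LowerPQ) → State L → Item → ℕ
tunnelCost c L s x = proj₂ (tunnel c L s x)

tunnelInsertCost : (c : ℕ) (L : LowerPQ) → State L → Item → ℕ
tunnelInsertCost c L s x =
  LowerPQ.insertCost L (heaps s (meta s (_%_ (counter s) (tB c) {{m^n≢0 2 c}}))) x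

module Submission where

-- The cost of level-i tunnel(x) is a sum of three parts: two units of
-- constant work (selecting a meta-heap index cyclically and recording x in
-- the level-i hash table), the level-(i-1) insert cost T, and -- only when x
-- becomes the local max of the chosen common-heap -- one meta-heap update.
-- The update starts at the selected index j < t_B and each sift-up swap
-- consumes one unit of fuel, initialised to j; so the update costs at most
-- 1 + j ≤ t_B, a constant depending only on c.  Hence
--     T_tunnel,i ≤ (2 + t_B) + T ≤ (3 + t_B) · T,
-- where the last step uses T ≥ 1 (every operation costs at least a unit).

open import Defs
open import Data.Nat using (ℕ; suc; _+_; _*_; _≤_; _<_; _<ᵇ_; _/_; _%_; s≤s; z≤n)
open import Data.Nat.Properties
  using (m^n≢0; ≤-trans; m≤m+n; m≤m*n; +-comm; +-monoʳ-≤; module ≤-Reasoning)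
open import Data.Nat.DivMod using (m%n<n)
open import Data.Bool using (true; false)
open import Data.Product using (∃; _,_; proj₂)
open import Relation.Binary.PropositionalEquality using (_≡_; cong)

siftUp-swaps≤fuel : ∀ keyOf arr fuel p → proj₂ (siftUp keyOf arr fuel p) ≤ fuel
siftUp-swaps≤fuel keyOf arr 0 p = z≤n
siftUp-swaps≤fuel keyOf arr (suc f) 0 = z≤n
siftUp-swaps≤fuel keyOf arr (suc f) (suc q)
  with keyOf (arr (q / 2)) <ᵇ keyOf (arr (suc q))
... | true  = s≤s (siftUp-swaps≤fuel keyOf _ f _)
... | false = z≤n

-- A meta-heap update started at index j costs at most 1 + j: sift-up from
-- index j can climb at most j levels (its fuel is j).
metaUpdate-cost≤ : ∀ L hs arr j → proj₂ (metaUpdate L hs arr j) ≤ suc j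
metaUpdate-cost≤ L hs arr j = s≤s (siftUp-swaps≤fuel _ arr j j)

selectedIndex<tB : ∀ c n → _%_ n (tB c) {{m^n≢0 2 c}} < tB c
selectedIndex<tB c n = m%n<n n (tB c) {{m^n≢0 2 c}}

-- Additive bound: tunnel() costs its level-(i-1) insert plus at most
-- 2 + t_B; the meta-heap update (if any) starts inside [0 , t_B).
tunnelCost≤ : ∀ c L s x → tunnelCost c L s x ≤ 2 + tunnelInsertCost c L s x + tB c
tunnelCost≤ c L s x
  with isLocalMax L (LowerPQ.insert L (heaps s (meta s j)) x) x
  where j = _%_ (counter s) (tB c) {{m^n≢0 2 c}}
... | true  = +-monoʳ-≤ (2 + tunnelInsertCost c L s x)
                (≤-trans (metaUpdate-cost≤ L _ (meta s) _) (selectedIndex<tB c (counter s)))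
... | false = m≤m+n _ _

additive≤multiplicative : ∀ a t → 1 ≤ t → a + t ≤ suc a * t
additive≤multiplicative a t@(suc _) _ = begin
  a + t      ≡⟨ +-comm a t ⟩
  t + a      ≤⟨ +-monoʳ-≤ t (m≤m*n a t) ⟩
  t + a * t  ∎
  where open ≤-Reasoning

mainTheorem4 : (c : ℕ) → ∃ λ (C : ℕ) →
    (L : LowerPQ) (k : ℕ) (s : State L) (x : Item) →
    tB c ≤ k →
    tunnelCost c L s x ≤ C * tunnelInsertCost c L s x
mainTheorem4 c = 3 + tB c , λ L k s x _ →
  let T = tunnelInsertCost c L s x
      j = _%_ (counter s) (tB c) {{m^n≢0 2 c}}
      T≥1 : 1 ≤ T
      T≥1 = LowerPQ.insertCost≥1 L (heaps s (meta s j)) x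
      rearrange : 2 + T + tB c ≡ (2 + tB c) + T
      rearrange = cong (2 +_) (+-comm T (tB c))
  in begin
     tunnelCost c L s x  ≤⟨ tunnelCost≤ c L s x ⟩
     2 + T + tB c        ≡⟨ rearrange ⟩
     (2 + tB c) + T      ≤⟨ additive≤multiplicative (2 + tB c) T T≥1 ⟩
     (3 + tB c) * T      ∎
  where open ≤-Reasoning
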